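{- Let $N$ be a positive integer, $A\subseteq[1,N]$, and let $m\geq3$ be an odd positive integer. If \[\frac{|A|}{N}\geq 4N^{ -2/(m-1)},\] then the difference set $A-A$ contains an arithmetic progression (with nonzero common difference) of length at least $m$.
   Context: $[1,N]=\{1,2,\dots,N\}$; $A-A=\{a-a':a,a'\in A\}$. -}

module Defs where

open import Data.Nat using (ℕ; _<_; _≤_)
open import Data.Integer using (ℤ; +_; _-_; _+_; _*_; 0ℤ)
open import Data.List using (List)
open import Data.List.Membership.Propositional using (_∈_)
open import Data.List.Relation.Unary.All using (All)
open import Data.Product using (Σ; ∃; ∃₂; _×_)
open import Relation.Binary.PropositionalEquality using (_≡_; _≢_)

-- A finite set of naturals, given as a duplicate-free list; A ⊆ [1,N].
InInterval : ℕ → ℕ → Set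
InInterval N x = 1 ≤ x × x ≤ N

InDiffSet : List ℕ → ℤ → Set
InDiffSet A z = ∃₂ λ x y → x ∈ A × y ∈ A × z ≡ (+ x) - (+ y)

ContainsAP : (ℤ → Set) → ℕ → Set
ContainsAP S ℓ = ∃₂ λ (a d : ℤ) → d ≢ 0ℤ × (∀ i → i < ℓ → S (a + (+ i) * d))

-- Put K = (m - 1)/2. Encode a tuple (a₁, …, a_K) ∈ A^K, with a₀ = 0 prepended, by its K - 1 second
-- differences a_{i-1} - 2a_i + a_{i+1}, shifted by 2N into [0, 4N). The density hypothesis says
-- |A|^K > (4N)^(K-1), so two distinct tuples a, b share this signature. Then a - b has vanishing
-- second differences and a₀ - b₀ = 0, so a_i - b_i = iD with D = a₁ - b₁ ≠ 0. Thus jD ∈ A - A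
-- for 0 ≤ j ≤ K, and by symmetry of A - A for |j| ≤ K: a progression of length 2K + 1 = m.
module Submission where

open import Defs
open import Data.Nat using (ℕ; _≤_; _^_; _*_; _∸_; _/_; _%_)
open import Data.List using (List; length)
open import Data.List.Relation.Unary.All using (All)
open import Data.List.Relation.Unary.Unique.Propositional using (Unique)
open import Data.Product using (∃; _×_)
open import Relation.Binary.PropositionalEquality using (_≡_)

open import Data.Nat as ℕ using (suc; zero; _+_; _<_; s≤s; NonZero)
import Data.Nat.Properties as ℕ
open import Data.Nat.DivMod using (m≡m%n+[m/n]*n; m*n/n≡m)
import Data.Nat.Tactic.RingSolver as ℕ-Ring
open import Data.Integer as ℤ using (ℤ; +_; 0ℤ)
import Data.Integer.Properties as ℤ
import Data.Integer.Tactic.RingSolver as ℤ-Ring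
open import Data.List as List using ([]; _∷_; cartesianProductWith; upTo)
import Data.List.Properties as List
open import Data.List.Membership.Propositional using (_∈_; find)
open import Data.List.Membership.Propositional.Properties using (∈-upTo⁺)
open import Data.List.Relation.Unary.Any as Any using (here; there; _─_; any?)
import Data.List.Relation.Unary.Any.Properties as Any
open import Data.List.Relation.Unary.All as All using ([]; _∷_)
import Data.List.Relation.Unary.All.Properties as All
import Data.List.Relation.Unary.Unique.Propositional.Properties as Unique
open import Data.List.Relation.Unary.AllPairs using ([]; _∷_)
open import Data.Product using (∃₂; _,_; proj₁; proj₂)
open import Data.Sum using (inj₁; inj₂)
open import Function using (_∘_)
open import Data.Unit using (⊤; tt)
open import Data.Empty using (⊥; ⊥-elim)
open import Relation.Nullary using (yes; no; contradiction)
open import Relation.Binary using (DecidableEquality)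
open import Relation.Binary.PropositionalEquality
  using (refl; sym; trans; cong; cong₂; subst; subst₂; _≢_; setoid; module ≡-Reasoning)

∈-─⁺ : ∀ {A : Set} {y u : A} {T} (y∈T : y ∈ T) → u ∈ T → u ≢ y → u ∈ (T ─ y∈T)
∈-─⁺ (here refl) (here refl) u≢y = ⊥-elim (u≢y refl)
∈-─⁺ (here refl) (there u∈T) _   = u∈T
∈-─⁺ (there y∈T) (here refl) _   = here refl
∈-─⁺ (there y∈T) (there u∈T) u≢y = there (∈-─⁺ y∈T u∈T u≢y)

pigeonhole : ∀ {X Y : Set} → DecidableEquality Y → (f : X → Y) {xs : List X} {T : List Y} →
  Unique xs → All (λ x → f x ∈ T) xs → length T < length xs →
  ∃₂ λ x y → x ∈ xs × y ∈ xs × x ≢ y × f x ≡ f y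
pigeonhole _≟_ f {x ∷ xs} {T} (x∉xs ∷ xs!) (fx∈T ∷ fxs∈T) |T|<|x∷xs|
  with any? (λ y → f x ≟ f y) xs
... | yes collision =
  let y , y∈xs , fx≡fy = find collision
  in x , y , here refl , there y∈xs , All.lookup x∉xs y∈xs , fx≡fy
... | no no-collision =
  let x₁ , x₂ , x₁∈ , x₂∈ , x₁≢x₂ , fx₁≡fx₂ =
        pigeonhole _≟_ f xs!
          (All.zipWith (λ (fy∈T , fx≢fy) → ∈-─⁺ fx∈T fy∈T (fx≢fy ∘ sym))
                       (fxs∈T , All.¬Any⇒All¬ xs no-collision))
          (ℕ.s≤s⁻¹ (subst (_< suc (length xs)) (List.length-removeAt′ T (Any.index fx∈T)) |T|<|x∷xs|))
  in x₁ , x₂ , there x₁∈ , there x₂∈ , x₁≢x₂ , fx₁≡fx₂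

tuples : ∀ {X : Set} → ℕ → List X → List (List X)
tuples zero    S = [] ∷ []
tuples (suc k) S = cartesianProductWith _∷_ S (tuples k S)

length-cartesianProductWith : ∀ {X Y W : Set} (g : X → Y → W) (xs : List X) (ys : List Y) →
  length (cartesianProductWith g xs ys) ≡ length xs * length ys
length-cartesianProductWith g []       ys = refl
length-cartesianProductWith g (x ∷ xs) ys = begin
  length (List.map (g x) ys List.++ cartesianProductWith g xs ys)
    ≡⟨ List.length-++ (List.map (g x) ys) ⟩
  length (List.map (g x) ys) + length (cartesianProductWith g xs ys)
    ≡⟨ cong₂ _+_ (List.length-map (g x) ys) (length-cartesianProductWith g xs ys) ⟩
  length ys + length xs * length ys ∎
  where open ≡-Reasoning

length-tuples : ∀ {X : Set} k (S : List X) → length (tuples k S) ≡ length S ^ k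
length-tuples zero    S = refl
length-tuples (suc k) S =
  trans (length-cartesianProductWith _∷_ S (tuples k S)) (cong (length S *_) (length-tuples k S))

tuples-unique : ∀ {X : Set} k {S : List X} → Unique S → Unique (tuples k S)
tuples-unique zero    S! = [] ∷ []
tuples-unique (suc k) S! = Unique.cartesianProductWith⁺ _∷_ List.∷-injective S! (tuples-unique k S!)

∈-tuples⁺ : ∀ {X : Set} {k} {S : List X} {v} → length v ≡ k → All (_∈ S) v → v ∈ tuples k S
∈-tuples⁺ {v = []}    refl []          = here refl
∈-tuples⁺ {v = _ ∷ _} refl (a∈S ∷ v∈S) = Any.cartesianProductWith⁺ _∷_ (cong₂ _∷_) a∈S (∈-tuples⁺ refl v∈S)

∈-tuples⁻ : ∀ {X : Set} k (S : List X) {v} → v ∈ tuples k S → length v ≡ k × All (_∈ S) v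
∈-tuples⁻ {X} k S = All.lookup (tuples-shape k)
  where
  tuples-shape : ∀ k → All (λ v → length v ≡ k × All (_∈ S) v) (tuples k S)
  tuples-shape zero    = (refl , []) ∷ []
  tuples-shape (suc k) = All.cartesianProductWith⁺ (setoid X) (setoid (List X)) _∷_ S (tuples k S)
    (λ a∈S v∈ → let |v|≡k , v⊆S = All.lookup (tuples-shape k) v∈ in cong suc |v|≡k , a∈S ∷ v⊆S)

pos-∸ : ∀ {m n} → n ≤ m → + (m ∸ n) ≡ + m ℤ.- + n
pos-∸ {m} {n} n≤m = trans (sym (ℤ.⊖-≥ n≤m)) (sym (ℤ.m-n≡m⊖n m n))

-- The second difference p - 2q + z, shifted by 2N so that it is a natural number whenever q ≤ N.
secondDiff : ℕ → ℕ → ℕ → ℕ → ℕ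
secondDiff N p q z = p + z + (N + N) ∸ (q + q)

secondDiffs : ℕ → ℕ → ℕ → List ℕ → List ℕ
secondDiffs N p q []      = []
secondDiffs N p q (z ∷ r) = secondDiff N p q z ∷ secondDiffs N q z r

-- The sentinel 0 in front of the tuple is what forces the differences of two tuples with equal
-- signatures to be D, 2D, 3D, … rather than an arbitrary arithmetic progression.
signature : ℕ → List ℕ → List ℕ
signature N []      = []
signature N (a ∷ r) = secondDiffs N 0 a r

length-secondDiffs : ∀ N p q r → length (secondDiffs N p q r) ≡ length r
length-secondDiffs N p q []      = refl
length-secondDiffs N p q (z ∷ r) = cong suc (length-secondDiffs N q z r)

q+q≤p+z+[N+N] : ∀ {N q} p z → q ≤ N → q + q ≤ p + z + (N + N)
q+q≤p+z+[N+N] {N} p z q≤N = ℕ.≤-trans (ℕ.+-mono-≤ q≤N q≤N) (ℕ.m≤n+m (N + N) (p + z))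

secondDiff<4N : ∀ {N p q z} → p ≤ N → InInterval N q → z ≤ N → secondDiff N p q z < 4 * N
secondDiff<4N {N} {p} {q} {z} p≤N (1≤q , q≤N) z≤N = begin-strict
  p + z + (N + N) ∸ (q + q)         <⟨ ℕ.∸-monoˡ-< p+z+[N+N]<q+q+4N (q+q≤p+z+[N+N] p z q≤N) ⟩
  q + q + 4 * N ∸ (q + q)           ≡⟨ ℕ.m+n∸m≡n (q + q) (4 * N) ⟩
  4 * N                             ∎
  where
  open ℕ.≤-Reasoning
  [n+n]+[n+n]≡4n : ∀ n → n + n + (n + n) ≡ 4 * n
  [n+n]+[n+n]≡4n = ℕ-Ring.solve-∀
  p+z+[N+N]<q+q+4N : p + z + (N + N) < q + q + 4 * N
  p+z+[N+N]<q+q+4N = begin-strict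
    p + z + (N + N)   ≤⟨ ℕ.+-monoˡ-≤ (N + N) (ℕ.+-mono-≤ p≤N z≤N) ⟩
    N + N + (N + N)   ≡⟨ [n+n]+[n+n]≡4n N ⟩
    4 * N             <⟨ ℕ.m<n+m (4 * N) (ℕ.≤-trans 1≤q (ℕ.m≤m+n q q)) ⟩
    q + q + 4 * N     ∎

secondDiffs<4N : ∀ {N p q r} → p ≤ N → All (InInterval N) (q ∷ r) → All (_< 4 * N) (secondDiffs N p q r)
secondDiffs<4N {r = []}    p≤N _                                  = []
secondDiffs<4N {r = _ ∷ _} p≤N ((1≤q , q≤N) ∷ z∈[1,N] ∷ r∈[1,N]) =
  secondDiff<4N p≤N (1≤q , q≤N) (proj₂ z∈[1,N]) ∷ secondDiffs<4N q≤N (z∈[1,N] ∷ r∈[1,N])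

secondDiff-≡⇒Δz≡2Δq-Δp : ∀ {N p q z p' q' z'} → q ≤ N → q' ≤ N → secondDiff N p q z ≡ secondDiff N p' q' z' →
  + z ℤ.- + z' ≡ (+ q ℤ.- + q') ℤ.+ (+ q ℤ.- + q') ℤ.- (+ p ℤ.- + p')
secondDiff-≡⇒Δz≡2Δq-Δp {N} {p} {q} {z} {p'} {q'} {z'} q≤N q'≤N eq = begin
  + z ℤ.- + z'               ≡⟨ z-z'≡ (+ p) (+ z) (+ q) (+ p') (+ z') (+ q') (+ N) ⟩
  (X ℤ.- X') ℤ.+ Δ           ≡⟨ cong (λ t → t ℤ.- X' ℤ.+ Δ) X≡X' ⟩
  (X' ℤ.- X') ℤ.+ Δ          ≡⟨ cong (ℤ._+ Δ) (ℤ.+-inverseʳ X') ⟩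
  0ℤ ℤ.+ Δ                   ≡⟨ ℤ.+-identityˡ Δ ⟩
  Δ                          ∎
  where
  open ≡-Reasoning
  X X' Δ : ℤ
  X  = + p  ℤ.+ + z  ℤ.+ (+ N ℤ.+ + N) ℤ.- (+ q  ℤ.+ + q)
  X' = + p' ℤ.+ + z' ℤ.+ (+ N ℤ.+ + N) ℤ.- (+ q' ℤ.+ + q')
  Δ  = (+ q ℤ.- + q') ℤ.+ (+ q ℤ.- + q') ℤ.- (+ p ℤ.- + p')
  X≡X' : X ≡ X'
  X≡X' = begin
    X                            ≡⟨ sym (pos-∸ (q+q≤p+z+[N+N] p z q≤N)) ⟩
    + secondDiff N p q z         ≡⟨ cong +_ eq ⟩
    + secondDiff N p' q' z'      ≡⟨ pos-∸ (q+q≤p+z+[N+N] p' z' q'≤N) ⟩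
    X'                           ∎
  z-z'≡ : ∀ p z q p' z' q' n → z ℤ.- z' ≡
    (p ℤ.+ z ℤ.+ (n ℤ.+ n) ℤ.- (q ℤ.+ q)) ℤ.- (p' ℤ.+ z' ℤ.+ (n ℤ.+ n) ℤ.- (q' ℤ.+ q'))
      ℤ.+ ((q ℤ.- q') ℤ.+ (q ℤ.- q') ℤ.- (p ℤ.- p'))
  z-z'≡ = ℤ-Ring.solve-∀

DiffsAreMultiples : ℤ → ℕ → List ℕ → List ℕ → Set
DiffsAreMultiples D j []       []       = ⊤
DiffsAreMultiples D j (x ∷ xs) (y ∷ ys) = + x ℤ.- + y ≡ + j ℤ.* D × DiffsAreMultiples D (suc j) xs ys
DiffsAreMultiples D j _        _        = ⊥

secondDiffs-≡⇒DiffsAreMultiples : ∀ {N p q r p' q' r' j D} →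
  All (_≤ N) (q ∷ r) → All (_≤ N) (q' ∷ r') →
  + p ℤ.- + p' ≡ + j ℤ.* D → + q ℤ.- + q' ≡ + suc j ℤ.* D →
  secondDiffs N p q r ≡ secondDiffs N p' q' r' → DiffsAreMultiples D (suc j) (q ∷ r) (q' ∷ r')
secondDiffs-≡⇒DiffsAreMultiples {r = []} {r' = []} _ _ _ q-q'≡ _ = q-q'≡ , tt
secondDiffs-≡⇒DiffsAreMultiples {p = p} {q} {z ∷ r} {p'} {q'} {z' ∷ r'} {j} {D}
  (q≤N ∷ zr≤N) (q'≤N ∷ z'r'≤N) p-p'≡ q-q'≡ eq =
  q-q'≡ , secondDiffs-≡⇒DiffsAreMultiples zr≤N z'r'≤N q-q'≡ z-z'≡ (proj₂ (List.∷-injective eq))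
  where
  open ≡-Reasoning
  progression : ∀ J D → (ℤ.1ℤ ℤ.+ J) ℤ.* D ℤ.+ (ℤ.1ℤ ℤ.+ J) ℤ.* D ℤ.- J ℤ.* D ≡ (+ 2 ℤ.+ J) ℤ.* D
  progression = ℤ-Ring.solve-∀
  z-z'≡ : + z ℤ.- + z' ≡ + suc (suc j) ℤ.* D
  z-z'≡ = begin
    + z ℤ.- + z'
      ≡⟨ secondDiff-≡⇒Δz≡2Δq-Δp {p = p} {z = z} {p' = p'} {z' = z'} q≤N q'≤N (proj₁ (List.∷-injective eq)) ⟩
    (+ q ℤ.- + q') ℤ.+ (+ q ℤ.- + q') ℤ.- (+ p ℤ.- + p')
      ≡⟨ cong₂ (λ s t → s ℤ.+ s ℤ.- t) q-q'≡ p-p'≡ ⟩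
    + suc j ℤ.* D ℤ.+ + suc j ℤ.* D ℤ.- + j ℤ.* D
      ≡⟨ progression (+ j) D ⟩
    + suc (suc j) ℤ.* D ∎

DiffsAreMultiples-0⇒≡ : ∀ {j xs ys} → DiffsAreMultiples 0ℤ j xs ys → xs ≡ ys
DiffsAreMultiples-0⇒≡ {xs = []} {[]} _ = refl
DiffsAreMultiples-0⇒≡ {j} {x ∷ xs} {y ∷ ys} (x-y≡ , xs~ys) =
  cong₂ _∷_ (ℤ.+-injective (ℤ.i-j≡0⇒i≡j (+ x) (+ y) (trans x-y≡ (ℤ.*-zeroʳ (+ j)))))
            (DiffsAreMultiples-0⇒≡ xs~ys)

DiffsAreMultiples⇒InDiffSet : ∀ {A D j xs ys} → All (_∈ A) xs → All (_∈ A) ys →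
  DiffsAreMultiples D j xs ys → ∀ i → i < length xs → InDiffSet A (+ (j + i) ℤ.* D)
DiffsAreMultiples⇒InDiffSet {A} {D} {j} {x ∷ _} {y ∷ _} (x∈A ∷ _) (y∈A ∷ _) (x-y≡ , _) zero _ =
  x , y , x∈A , y∈A , sym (subst (λ k → + x ℤ.- + y ≡ + k ℤ.* D) (sym (ℕ.+-identityʳ j)) x-y≡)
DiffsAreMultiples⇒InDiffSet {A} {D} {j} {_ ∷ _} {_ ∷ _} (_ ∷ xs⊆A) (_ ∷ ys⊆A) (_ , xs~ys) (suc i) (s≤s i<|xs|) =
  subst (λ k → InDiffSet A (+ k ℤ.* D)) (sym (ℕ.+-suc j i))
    (DiffsAreMultiples⇒InDiffSet xs⊆A ys⊆A xs~ys i i<|xs|)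

signature-≡⇒DiffsAreMultiples : ∀ {N a r b r'} → All (_≤ N) (a ∷ r) → All (_≤ N) (b ∷ r') →
  signature N (a ∷ r) ≡ signature N (b ∷ r') → DiffsAreMultiples (+ a ℤ.- + b) 1 (a ∷ r) (b ∷ r')
signature-≡⇒DiffsAreMultiples ar≤N br'≤N =
  secondDiffs-≡⇒DiffsAreMultiples ar≤N br'≤N refl (sym (ℤ.*-identityˡ _))

signature∈tuples : ∀ {N k v} → length v ≡ suc k → All (InInterval N) v →
  signature N v ∈ tuples k (upTo (4 * N))
signature∈tuples {N} {v = a ∷ r} refl ar∈[1,N] =
  ∈-tuples⁺ (length-secondDiffs N 0 a r) (All.map ∈-upTo⁺ (secondDiffs<4N ℕ.z≤n ar∈[1,N]))

InDiffSet-neg : ∀ {A z} → InDiffSet A z → InDiffSet A (ℤ.- z)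
InDiffSet-neg (x , y , x∈A , y∈A , z≡x-y) =
  y , x , y∈A , x∈A , trans (cong ℤ.-_ z≡x-y) (-[x-y]≡y-x (+ x) (+ y))
  where
  -[x-y]≡y-x : ∀ x y → ℤ.- (x ℤ.- y) ≡ y ℤ.- x
  -[x-y]≡y-x = ℤ-Ring.solve-∀

centred-multiple : ∀ {S : ℤ → Set} {D} → (∀ {z} → S z → S (ℤ.- z)) →
  ∀ k → (∀ j → j ≤ k → S (+ j ℤ.* D)) → ∀ i → i ≤ k + k → S (ℤ.- (+ k ℤ.* D) ℤ.+ + i ℤ.* D)
centred-multiple {S} {D} S-neg k multiple i i≤2k with ℕ.≤-total k i
... | inj₁ k≤i with ℕ.m≤n⇒∃[o]m+o≡n k≤i
...   | j , refl = subst S (sym (-kD+[k+j]D≡jD (+ k) (+ j) D)) (multiple j (ℕ.+-cancelˡ-≤ k j k i≤2k))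
  where
  -kD+[k+j]D≡jD : ∀ k j D → ℤ.- (k ℤ.* D) ℤ.+ (k ℤ.+ j) ℤ.* D ≡ j ℤ.* D
  -kD+[k+j]D≡jD = ℤ-Ring.solve-∀
centred-multiple {S} {D} S-neg k multiple i i≤2k | inj₂ i≤k with ℕ.m≤n⇒∃[o]m+o≡n i≤k
...   | j , refl = subst S (sym (-[i+j]D+iD≡-jD (+ i) (+ j) D)) (S-neg (multiple j (ℕ.m≤n+m j i)))
  where
  -[i+j]D+iD≡-jD : ∀ i j D → ℤ.- ((i ℤ.+ j) ℤ.* D) ℤ.+ i ℤ.* D ≡ ℤ.- (j ℤ.* D)
  -[i+j]D+iD≡-jD = ℤ-Ring.solve-∀

multiples⇒ContainsAP : ∀ {S : ℤ → Set} {D} k → (∀ {z} → S z → S (ℤ.- z)) → D ≢ 0ℤ →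
  (∀ j → j ≤ k → S (+ j ℤ.* D)) → ContainsAP S (suc (k + k))
multiples⇒ContainsAP {S} {D} k S-neg D≢0 multiple =
  ℤ.- (+ k ℤ.* D) , D , D≢0 , λ i i<1+2k → centred-multiple {S} S-neg k multiple i (ℕ.s≤s⁻¹ i<1+2k)

^-distribʳ-* : ∀ m n k → (m * n) ^ k ≡ m ^ k * n ^ k
^-distribʳ-* m n zero    = refl
^-distribʳ-* m n (suc k) = begin
  m * n * (m * n) ^ k        ≡⟨ cong (m * n *_) (^-distribʳ-* m n k) ⟩
  m * n * (m ^ k * n ^ k)    ≡⟨ [mn][ab]≡[ma][nb] m n (m ^ k) (n ^ k) ⟩
  m * m ^ k * (n * n ^ k)    ∎
  where
  open ≡-Reasoning
  [mn][ab]≡[ma][nb] : ∀ m n a b → m * n * (a * b) ≡ m * a * (n * b)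
  [mn][ab]≡[ma][nb] = ℕ-Ring.solve-∀

[4N]^k<a^[1+k] : ∀ N .{{_ : NonZero N}} a k →
  4 ^ suc k * N ^ suc k ≤ a ^ suc k * N → (4 * N) ^ k < a ^ suc k
[4N]^k<a^[1+k] N a k density = ℕ.*-cancelʳ-< N ((4 * N) ^ k) (a ^ suc k) (begin-strict
  (4 * N) ^ k * N              <⟨ ℕ.m<m*n ((4 * N) ^ k * N) 4 (s≤s (s≤s ℕ.z≤n)) ⟩
  (4 * N) ^ k * N * 4          ≡⟨ cong (λ t → t * N * 4) (^-distribʳ-* 4 N k) ⟩
  4 ^ k * N ^ k * N * 4        ≡⟨ [ab]n4≡[4a][nb] (4 ^ k) (N ^ k) N ⟩
  4 ^ suc k * N ^ suc k        ≤⟨ density ⟩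
  a ^ suc k * N                ∎)
  where
  open ℕ.≤-Reasoning
  instance
    4N≢0 : NonZero (4 * N)
    4N≢0 = ℕ.m*n≢0 4 N
    [4N]^k≢0 : NonZero ((4 * N) ^ k)
    [4N]^k≢0 = ℕ.m^n≢0 (4 * N) k
    [4N]^kN≢0 : NonZero ((4 * N) ^ k * N)
    [4N]^kN≢0 = ℕ.m*n≢0 ((4 * N) ^ k) N
  [ab]n4≡[4a][nb] : ∀ a b n → a * b * n * 4 ≡ 4 * a * (n * b)
  [ab]n4≡[4a][nb] = ℕ-Ring.solve-∀

m%2≡1⇒m≡1+[m∸1]/2+[m∸1]/2 : ∀ {m} → m % 2 ≡ 1 → m ≡ suc ((m ∸ 1) / 2 + (m ∸ 1) / 2)
m%2≡1⇒m≡1+[m∸1]/2+[m∸1]/2 {m} m%2≡1 = begin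
  m                  ≡⟨ m≡1+h*2 ⟩
  1 + h * 2          ≡⟨ 1+h*2≡1+h+h h ⟩
  suc (h + h)        ≡⟨ cong (λ t → suc (t + t)) (sym [m∸1]/2≡h) ⟩
  suc ((m ∸ 1) / 2 + (m ∸ 1) / 2) ∎
  where
  open ≡-Reasoning
  h : ℕ
  h = m / 2
  m≡1+h*2 : m ≡ 1 + h * 2
  m≡1+h*2 = trans (m≡m%n+[m/n]*n m 2) (cong (_+ h * 2) m%2≡1)
  [m∸1]/2≡h : (m ∸ 1) / 2 ≡ h
  [m∸1]/2≡h = trans (cong (λ t → (t ∸ 1) / 2) m≡1+h*2) (m*n/n≡m h 2)
  1+h*2≡1+h+h : ∀ h → 1 + h * 2 ≡ suc (h + h)
  1+h*2≡1+h+h = ℕ-Ring.solve-∀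

collision⇒multiples : ∀ {N A x y} k → All (InInterval N) A →
  x ∈ tuples (suc k) A → y ∈ tuples (suc k) A → x ≢ y → signature N x ≡ signature N y →
  ∃ λ D → D ≢ 0ℤ × (∀ j → j ≤ suc k → InDiffSet A (+ j ℤ.* D))
collision⇒multiples {A = A} k A⊆[1,N] x∈ y∈ x≢y sig≡
  with ∈-tuples⁻ (suc k) A x∈ | ∈-tuples⁻ (suc k) A y∈
collision⇒multiples {N} {A} {a ∷ r} {b ∷ r'} k A⊆[1,N] _ _ x≢y sig≡ | |x|≡1+k , x⊆A | _ , y⊆A =
  D , D≢0 , multiple
  where
  D : ℤ
  D = + a ℤ.- + b
  ≤N : ∀ {v} → All (_∈ A) v → All (_≤ N) v
  ≤N = All.map (λ v∈A → proj₂ (All.lookup A⊆[1,N] v∈A))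
  diffs : DiffsAreMultiples D 1 (a ∷ r) (b ∷ r')
  diffs = signature-≡⇒DiffsAreMultiples (≤N x⊆A) (≤N y⊆A) sig≡
  D≢0 : D ≢ 0ℤ
  D≢0 D≡0 = x≢y (DiffsAreMultiples-0⇒≡ (subst (λ D → DiffsAreMultiples D 1 (a ∷ r) (b ∷ r')) D≡0 diffs))
  multiple : ∀ j → j ≤ suc k → InDiffSet A (+ j ℤ.* D)
  multiple zero    _         = a , a , All.head x⊆A , All.head x⊆A , sym (ℤ.+-inverseʳ (+ a))
  multiple (suc i) 1+i≤1+k = DiffsAreMultiples⇒InDiffSet x⊆A y⊆A diffs i (subst (i <_) (sym |x|≡1+k) 1+i≤1+k)

dense⇒multiples : ∀ {N A} .{{_ : NonZero N}} k → Unique A → All (InInterval N) A →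
  (4 * N) ^ k < length A ^ suc k → ∃ λ D → D ≢ 0ℤ × (∀ j → j ≤ suc k → InDiffSet A (+ j ℤ.* D))
dense⇒multiples {N} {A} k A! A⊆[1,N] count =
  let x , y , x∈ , y∈ , x≢y , sig≡ =
        pigeonhole (List.≡-dec ℕ._≟_) (signature N) (tuples-unique (suc k) A!)
          (All.tabulate λ v∈ → let |v|≡1+k , v⊆A = ∈-tuples⁻ (suc k) A v∈
                                in signature∈tuples |v|≡1+k (All.map (All.lookup A⊆[1,N]) v⊆A))
          (subst₂ _<_ (sym (trans (length-tuples k _) (cong (_^ k) (List.length-upTo (4 * N)))))
                      (sym (length-tuples (suc k) A)) count)
  in collision⇒multiples k A⊆[1,N] x∈ y∈ x≢y sig≡

dense⇒AP : ∀ {N A} .{{_ : NonZero N}} k → Unique A → All (InInterval N) A →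
  4 ^ suc k * N ^ suc k ≤ length A ^ suc k * N → ContainsAP (InDiffSet A) (suc (suc k + suc k))
dense⇒AP {N} {A} k A! A⊆[1,N] density =
  let D , D≢0 , multiple = dense⇒multiples k A! A⊆[1,N] ([4N]^k<a^[1+k] N (length A) k density)
  in multiples⇒ContainsAP {InDiffSet A} {D} (suc k) InDiffSet-neg D≢0 multiple

theorem2p1 : (N : ℕ) → 1 ≤ N → (A : List ℕ) → Unique A → All (InInterval N) A →
    (m : ℕ) → 3 ≤ m → m % 2 ≡ 1 →
    4 ^ ((m ∸ 1) / 2) * N ^ ((m ∸ 1) / 2) ≤ length A ^ ((m ∸ 1) / 2) * N →
    ∃ λ ℓ → m ≤ ℓ × ContainsAP (InDiffSet A) ℓ
theorem2p1 N@(suc _) _ A A! A⊆[1,N] m 3≤m m%2≡1 density =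
  m , ℕ.≤-refl , subst (ContainsAP (InDiffSet A)) (sym m≡1+k+k) (AP ((m ∸ 1) / 2) m≡1+k+k density)
  where
  m≡1+k+k : m ≡ suc ((m ∸ 1) / 2 + (m ∸ 1) / 2)
  m≡1+k+k = m%2≡1⇒m≡1+[m∸1]/2+[m∸1]/2 {m} m%2≡1
  AP : ∀ k → m ≡ suc (k + k) → 4 ^ k * N ^ k ≤ length A ^ k * N → ContainsAP (InDiffSet A) (suc (k + k))
  AP zero    m≡1 _       = contradiction (subst (3 ≤_) m≡1 3≤m) λ { (s≤s ()) }
  AP (suc k) _   density = dense⇒AP k A! A⊆[1,N] density
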